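{- Let $m\ge 2$ be an integer and let $\Gamma$ be a strongly regular bicirculant with parameters $(2(2m^2+2m+1),\,m(2m+1),\,m^2-1,\,m^2)$. Let $(x,y)$ be a $3$-isoregular edge of $\Gamma$ with associated parameters $Q,R,W$. Then $m$ is odd and $$Q=\frac{m^2-m-4}{2},\qquad R=\frac{m^2-1}{2},\qquad W=\frac{m(m-1)}{2}.$$
   Context: All graphs are finite and simple. A strongly regular graph with parameters $(N,k,\lambda,\mu)$ is a $k$-regular graph on $N$ vertices in which adjacent vertices have exactly $\lambda$ common neighbours and distinct non-adjacent vertices have exactly $\mu$ common neighbours. A bicirculant is a graph on $2n$ vertices admitting an automorphism whose cycle decomposition consists of exactly two cycles of length $n$. For a vertex set $T$, the valency of $T$ is the number of vertices adjacent to every vertex of $T$. An ordered pair $(x,y)$ of distinct vertices is $3$-isoregular if for all vertices $z\ne x,y$ the valency of $\{x,y,z\}$ depends only on the isomorphism type of the subgraph induced on $\{x,y,z\}$. For a $3$-isoregular edge $(x,y)$, the associated parameters $Q,R,W$ are the valencies of $\{x,y,z\}$ when the induced subgraph on $\{x,y,z\}$ is isomorphic to $K_3$, $K_{1,2}$, or $K_2+K_1$, respectively. -}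

module Defs where

open import Data.Nat using (ℕ; zero; suc; _+_; _*_)
open import Data.Bool using (Bool; true; false; _∧_; T)
open import Data.Fin using (Fin; zero; suc)
open import Data.List using (List; filterᵇ; length; allFin)
open import Data.Product using (Σ; _×_; _,_; ∃)
open import Relation.Binary.PropositionalEquality using (_≡_; _≢_)
open import Relation.Nullary using (¬_)
open import Function.Bundles using (_↔_; Inverse)
open import Data.Fin using (toℕ; fromℕ<)
open import Data.Nat.DivMod using (_%_; m%n<n)

record Graph (N : ℕ) : Set where
  field
    adj       : Fin N → Fin N → Bool
    symmetric : ∀ u v → adj u v ≡ adj v u
    irreflex  : ∀ v → adj v v ≡ false
open Graph public

Adj : ∀ {N} → Graph N → Fin N → Fin N → Set
Adj G u v = T (adj G u v)

count : ∀ {N} → (Fin N → Bool) → ℕ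
count {N} p = length (filterᵇ p (allFin N))

commonNbrs : ∀ {N} → Graph N → Fin N → Fin N → ℕ
commonNbrs G u v = count (λ w → adj G u w ∧ adj G v w)

degree : ∀ {N} → Graph N → Fin N → ℕ
degree G u = count (λ w → adj G u w)

valency3 : ∀ {N} → Graph N → Fin N → Fin N → Fin N → ℕ
valency3 G x y z = count (λ w → adj G x w ∧ adj G y w ∧ adj G z w)

IsStronglyRegular : ∀ {N} → Graph N → ℕ → ℕ → ℕ → Set
IsStronglyRegular G k λ' μ =
  (∀ u → degree G u ≡ k) ×
  (∀ u v → u ≢ v → Adj G u v → commonNbrs G u v ≡ λ') ×
  (∀ u v → u ≢ v → ¬ (Adj G u v) → commonNbrs G u v ≡ μ)

IsAutomorphism : ∀ {N} → Graph N → (σ : Fin N ↔ Fin N) → Set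
IsAutomorphism {N} G σ = ∀ u v → adj G (Inverse.to σ u) (Inverse.to σ v) ≡ adj G u v

sucMod : ∀ {n} → Fin (suc n) → Fin (suc n)
sucMod {n} i = fromℕ< (m%n<n (suc (toℕ i)) (suc n))

-- Γ (on 2n vertices, n ≥ 1) is a bicirculant: there is an automorphism σ whose cycle
-- decomposition consists of exactly two n-cycles.  Equivalently, the vertices can be
-- labelled bijectively by Fin 2 × Fin n via φ such that σ (φ (i , j)) = φ (i , j+1 mod n).
IsBicirculant : ∀ {n} → Graph (2 * suc n) → Set
IsBicirculant {n} G =
  Σ (Fin (2 * suc n) ↔ Fin (2 * suc n)) λ σ →
  Σ ((Fin 2 × Fin (suc n)) ↔ Fin (2 * suc n)) λ φ →
    IsAutomorphism G σ ×
    (∀ i j → Inverse.to σ (Inverse.to φ (i , j)) ≡ Inverse.to φ (i , sucMod j))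

-- (x , y) is a 3-isoregular edge with associated parameters Q, R, W:
-- x ~ y, and for every z ∉ {x , y} the valency of {x , y , z} is
--   Q  if {x,y,z} induces K₃        (z ~ x and z ~ y),
--   R  if {x,y,z} induces K_{1,2}   (z adjacent to exactly one of x, y),
--   W  if {x,y,z} induces K₂ + K₁   (z adjacent to neither).
-- (Since x ~ y these are the only isomorphism types that can occur.)
Is3IsoregularEdge : ∀ {N} → Graph N → Fin N → Fin N → ℕ → ℕ → ℕ → Set
Is3IsoregularEdge G x y Q R W =
  x ≢ y × Adj G x y ×
  (∀ z → z ≢ x → z ≢ y →
     (Adj G z x → Adj G z y → valency3 G x y z ≡ Q) ×
     (Adj G z x → ¬ Adj G z y → valency3 G x y z ≡ R) ×
     (¬ Adj G z x → Adj G z y → valency3 G x y z ≡ R) ×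
     (¬ Adj G z x → ¬ Adj G z y → valency3 G x y z ≡ W))

module Submission where

-- Let V(z) be the number of common neighbours of x, y and z. The sums of V, of V over the
-- neighbours of x, and of V² are computed in two ways: by the isomorphism type of {x, y, z},
-- whose six vertex classes have sizes fixed by strong regularity, and by exchanging the
-- summations, so that each common neighbour w of x and y contributes its degree k, the
-- number λ of common neighbours of x and w, and k + λQ + μ(λ - 1 - Q) respectively. For the
-- given parameters the two linear equations express R and W through Q, and the quadratic
-- one becomes (2Q - m² + m + 4)((2m² - 1)Q - (m⁴ - 3m² + m + 2)) = 0. A root of the second
-- factor would make 2m² - 1 divide 4m + 3, impossible for m ≥ 2; the first factor gives Q,
-- then R and W, and 2R + 1 = m² forces m to be odd.

open import Defs

module IversonSums where

  open import Data.Bool using (Bool; true; false; _∧_)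
  open import Data.Fin using (Fin; zero; suc)
  open import Data.Fin.Properties using (_≟_)
  open import Data.Integer using (ℤ; +_; 0ℤ; 1ℤ; _+_; _*_; _-_)
  import Data.Integer.Properties as ℤ
  open import Data.Integer.Tactic.RingSolver using (solve-∀)
  open import Data.List using (filterᵇ; length; tabulate)
  open import Data.Nat using (zero; suc)
  open import Data.Empty using (⊥-elim)
  open import Relation.Binary.PropositionalEquality
    using (_≡_; _≢_; refl; sym; trans; cong; cong₂; ≢-sym; module ≡-Reasoning)
  open import Relation.Nullary using (does; yes; no)
  open import Algebra.Properties.Semiring.Sum ℤ.+-*-semiring public
    using (sum; ∑-distrib-+; ∑-comm; sum-cong-≗; *-distribˡ-sum; sum-replicate-zero)
  open ≡-Reasoning

  [_] : Bool → ℤ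
  [ true ]  = 1ℤ
  [ false ] = 0ℤ

  [∧] : ∀ a b → [ a ∧ b ] ≡ [ a ] * [ b ]
  [∧] true  b = sym (ℤ.*-identityˡ [ b ])
  [∧] false b = refl

  []-idem : ∀ a → [ a ] * [ a ] ≡ [ a ]
  []-idem true  = refl
  []-idem false = refl

  length-filter-tabulate : ∀ {n N} (g : Fin n → Fin N) (p : Fin N → Bool) →
    + length (filterᵇ p (tabulate g)) ≡ sum (λ i → [ p (g i) ])
  length-filter-tabulate {zero}  g p = refl
  length-filter-tabulate {suc n} g p with p (g zero)
  ... | true  = trans (ℤ.pos-+ 1 _) (cong (_+_ 1ℤ) (length-filter-tabulate (λ i → g (suc i)) p))
  ... | false = trans (length-filter-tabulate (λ i → g (suc i)) p) (sym (ℤ.+-identityˡ _))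

  count≡sum : ∀ {N} (p : Fin N → Bool) → + count p ≡ sum (λ i → [ p i ])
  count≡sum p = length-filter-tabulate (λ i → i) p

  δ : ∀ {n} → Fin n → Fin n → ℤ
  δ u v = [ does (u ≟ v) ]

  sum-δ : ∀ {n} (u : Fin n) (f : Fin n → ℤ) → sum (λ v → δ u v * f v) ≡ f u
  sum-δ {suc n} zero    f =
    trans (cong₂ _+_ (ℤ.*-identityˡ (f zero)) (sum-replicate-zero n)) (ℤ.+-identityʳ (f zero))
  sum-δ {suc n} (suc u) f = trans (ℤ.+-identityˡ _) (sum-δ u (λ v → f (suc v)))

  sum-const : ∀ n (c : ℤ) → sum {n} (λ _ → c) ≡ + n * c
  sum-const zero    c = refl
  sum-const (suc n) c = begin
    c + sum {n} (λ _ → c)  ≡⟨ cong (_+_ c) (sum-const n c) ⟩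
    c + + n * c            ≡⟨ cong (_+ + n * c) (sym (ℤ.*-identityˡ c)) ⟩
    1ℤ * c + + n * c       ≡⟨ sym (ℤ.*-distribʳ-+ c 1ℤ (+ n)) ⟩
    (1ℤ + + n) * c         ≡⟨ cong (_* c) (sym (ℤ.pos-+ 1 n)) ⟩
    + suc n * c            ∎

  sum-+-* : ∀ {n} (f g : Fin n → ℤ) c → sum (λ i → f i + c * g i) ≡ sum f + c * sum g
  sum-+-* f g c = trans (∑-distrib-+ f (λ i → c * g i)) (cong (_+_ (sum f)) (sym (*-distribˡ-sum c g)))

  bilinear : ∀ (h : Bool → Bool → ℤ) a b →
    h a b ≡ h false false + (h true false - h false false) * [ a ] + (h false true - h false false) * [ b ]
            + (h true true - h true false - h false true + h false false) * ([ a ] * [ b ])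
  bilinear h true  true  = corner₁₁ (h true true) (h true false) (h false true) (h false false)
    where corner₁₁ : ∀ t u v w → t ≡ w + (u - w) * 1ℤ + (v - w) * 1ℤ + (t - u - v + w) * (1ℤ * 1ℤ)
          corner₁₁ = solve-∀
  bilinear h true  false = corner₁₀ (h true true) (h true false) (h false true) (h false false)
    where corner₁₀ : ∀ t u v w → u ≡ w + (u - w) * 1ℤ + (v - w) * 0ℤ + (t - u - v + w) * (1ℤ * 0ℤ)
          corner₁₀ = solve-∀
  bilinear h false true  = corner₀₁ (h true true) (h true false) (h false true) (h false false)
    where corner₀₁ : ∀ t u v w → v ≡ w + (u - w) * 0ℤ + (v - w) * 1ℤ + (t - u - v + w) * (0ℤ * 1ℤ)
          corner₀₁ = solve-∀
  bilinear h false false = corner₀₀ (h true true) (h true false) (h false true) (h false false)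
    where corner₀₀ : ∀ t u v w → w ≡ w + (u - w) * 0ℤ + (v - w) * 0ℤ + (t - u - v + w) * (0ℤ * 0ℤ)
          corner₀₀ = solve-∀

  sum-bilinear : ∀ {n} (p q : Fin n → Bool) (h : Bool → Bool → ℤ) {sp sq spq : ℤ} →
    sum (λ i → [ p i ]) ≡ sp → sum (λ i → [ q i ]) ≡ sq → sum (λ i → [ p i ] * [ q i ]) ≡ spq →
    sum (λ i → h (p i) (q i)) ≡
      + n * h false false + (h true false - h false false) * sp + (h false true - h false false) * sq
      + (h true true - h true false - h false true + h false false) * spq
  sum-bilinear {n} p q h {sp} {sq} {spq} sp-eq sq-eq spq-eq = begin
    sum (λ i → h (p i) (q i))
      ≡⟨ sum-cong-≗ (λ i → bilinear h (p i) (q i)) ⟩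
    sum (λ i → h₀₀ + c₁ * [ p i ] + c₂ * [ q i ] + c₃ * ([ p i ] * [ q i ]))
      ≡⟨ sum-+-* (λ i → h₀₀ + c₁ * [ p i ] + c₂ * [ q i ]) (λ i → [ p i ] * [ q i ]) c₃ ⟩
    sum (λ i → h₀₀ + c₁ * [ p i ] + c₂ * [ q i ]) + c₃ * sum (λ i → [ p i ] * [ q i ])
      ≡⟨ cong₂ (λ s r → s + c₃ * r)
               (sum-+-* (λ i → h₀₀ + c₁ * [ p i ]) (λ i → [ q i ]) c₂) spq-eq ⟩
    sum (λ i → h₀₀ + c₁ * [ p i ]) + c₂ * sum (λ i → [ q i ]) + c₃ * spq
      ≡⟨ cong₂ (λ s r → s + c₂ * r + c₃ * spq)
               (sum-+-* {n} (λ _ → h₀₀) (λ i → [ p i ]) c₁) sq-eq ⟩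
    sum {n} (λ _ → h₀₀) + c₁ * sum (λ i → [ p i ]) + c₂ * sq + c₃ * spq
      ≡⟨ cong₂ (λ s r → s + c₁ * r + c₂ * sq + c₃ * spq) (sum-const n h₀₀) sp-eq ⟩
    + n * h₀₀ + c₁ * sp + c₂ * sq + c₃ * spq
      ∎
    where
    h₀₀ = h false false
    c₁ = h true false - h false false
    c₂ = h false true - h false false
    c₃ = h true true - h true false - h false true + h false false

  sum-supported-on-pair : ∀ {n} {x y : Fin n} (f : Fin n → ℤ) → x ≢ y →
    (∀ z → z ≢ x → z ≢ y → f z ≡ 0ℤ) → sum f ≡ f x + f y
  sum-supported-on-pair {x = x} {y} f x≢y vanishes = begin
    sum f
      ≡⟨ sum-cong-≗ at ⟩
    sum (λ z → δ x z * f x + δ y z * f y)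
      ≡⟨ ∑-distrib-+ (λ z → δ x z * f x) (λ z → δ y z * f y) ⟩
    sum (λ z → δ x z * f x) + sum (λ z → δ y z * f y)
      ≡⟨ cong₂ _+_ (sum-δ x _) (sum-δ y _) ⟩
    f x + f y
      ∎
    where
    at : ∀ z → f z ≡ δ x z * f x + δ y z * f y
    at z with x ≟ z | y ≟ z
    ... | yes refl | yes refl = ⊥-elim (x≢y refl)
    ... | yes refl | no _     = sym (trans (ℤ.+-identityʳ _) (ℤ.*-identityˡ (f x)))
    ... | no _     | yes refl = sym (trans (ℤ.+-identityˡ _) (ℤ.*-identityˡ (f y)))
    ... | no x≢z   | no y≢z   = vanishes z (≢-sym x≢z) (≢-sym y≢z)

module Counting where

  open IversonSums
  open import Data.Bool using (Bool; true; false; T; _∧_)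
  open import Data.Bool.Properties using (T-≡)
  open import Data.Fin using (Fin)
  open import Data.Integer using (ℤ; +_; 0ℤ; 1ℤ; _+_; _*_; _-_)
  import Data.Integer.Properties as ℤ
  open import Data.Integer.Tactic.RingSolver using (solve-∀)
  open import Data.Nat using (ℕ)
  open import Data.Product using (_,_; proj₁; proj₂)
  open import Function.Bundles using (Equivalence)
  open import Relation.Binary.PropositionalEquality
    using (_≡_; _≢_; refl; sym; trans; cong; cong₂; subst; ≢-sym; module ≡-Reasoning)
  open import Relation.Nullary using (¬_; yes; no)
  open import Data.Fin.Properties using (_≟_)
  open import Algebra.Properties.CommutativeSemigroup ℤ.*-commutativeSemigroup using (x∙yz≈y∙xz)
  open ≡-Reasoning

  -- Summands are listed by vertex class: x, y, common neighbours, neighbours of x only,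
  -- of y only, neither; the class sizes are 1, 1, λ, k - 1 - λ, k - 1 - λ, N - 2k + λ.
  record IsoregularEquations (k l u n Q R W : ℤ) : Set where
    field
      neighbour-valency-sum : l + l * Q + (k - 1ℤ - l) * R ≡ l * l
      valency-sum           : l + l + l * Q + (k - 1ℤ - l) * R + (k - 1ℤ - l) * R
                                + (n - (k + k) + l) * W ≡ k * l
      valency-square-sum    : l * l + l * l + l * (Q * Q) + (k - 1ℤ - l) * (R * R)
                                + (k - 1ℤ - l) * (R * R) + (n - (k + k) + l) * (W * W)
                                ≡ (k + l * Q + u * (l - 1ℤ - Q)) * l

  module _ {N : ℕ} (G : Graph N) where

    A : Fin N → Fin N → ℤ
    A u v = [ adj G u v ]

    valency : Fin N → Fin N → Fin N → ℤ
    valency x y z = sum (λ w → A x w * A y w * A z w)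

    valency3≡valency : ∀ x y z → + valency3 G x y z ≡ valency x y z
    valency3≡valency x y z =
      trans (count≡sum (λ w → adj G x w ∧ adj G y w ∧ adj G z w)) (sum-cong-≗ λ w →
      trans ([∧] (adj G x w) _) (trans (cong (A x w *_) ([∧] (adj G y w) _)) (sym (ℤ.*-assoc (A x w) _ _))))

    commonNbrs≡sum : ∀ u v → + commonNbrs G u v ≡ sum (λ z → A u z * A v z)
    commonNbrs≡sum u v =
      trans (count≡sum (λ z → adj G u z ∧ adj G v z)) (sum-cong-≗ λ z → [∧] (adj G u z) (adj G v z))

    double-counting : ∀ x y (P : Fin N → ℤ) →
      sum (λ z → P z * valency x y z) ≡ sum (λ w → A x w * A y w * sum (λ z → P z * A w z))
    double-counting x y P = begin
      sum (λ z → P z * sum (λ w → Λ w * A z w))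
        ≡⟨ sum-cong-≗ (λ z → *-distribˡ-sum (P z) (λ w → Λ w * A z w)) ⟩
      sum (λ z → sum (λ w → P z * (Λ w * A z w)))
        ≡⟨ ∑-comm (λ z w → P z * (Λ w * A z w)) ⟩
      sum (λ w → sum (λ z → P z * (Λ w * A z w)))
        ≡⟨ sum-cong-≗ (λ w → sum-cong-≗ (λ z → swap z w)) ⟩
      sum (λ w → sum (λ z → Λ w * (P z * A w z)))
        ≡⟨ sum-cong-≗ (λ w → sym (*-distribˡ-sum (Λ w) (λ z → P z * A w z))) ⟩
      sum (λ w → Λ w * sum (λ z → P z * A w z))
        ∎
      where
      Λ : Fin N → ℤ
      Λ w = A x w * A y w
      swap : ∀ z w → P z * (Λ w * A z w) ≡ Λ w * (P z * A w z)
      swap z w = trans (x∙yz≈y∙xz (P z) (Λ w) (A z w)) (cong (λ t → Λ w * (P z * [ t ])) (symmetric G z w))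

    ∼⇒Adj : ∀ {u v} → adj G u v ≡ true → Adj G v u
    ∼⇒Adj {u} {v} e = Equivalence.from T-≡ (trans (symmetric G v u) e)

    ≁⇒¬Adj : ∀ {u v} → adj G u v ≡ false → ¬ Adj G v u
    ≁⇒¬Adj {u} {v} e = subst T (trans (symmetric G v u) e)

    ∼⇒≢ : ∀ {u v} → adj G u v ≡ true → u ≢ v
    ∼⇒≢ {u} e refl with trans (sym e) (irreflex G u)
    ... | ()

  module StronglyRegular {N : ℕ} (G : Graph N) {k λ′ μ : ℕ} (srg : IsStronglyRegular G k λ′ μ) where

    row-sum : ∀ u → sum (A G u) ≡ + k
    row-sum u = trans (sym (count≡sum (adj G u))) (cong +_ (proj₁ srg u))

    common-self : ∀ u → sum (λ z → A G u z * A G u z) ≡ + k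
    common-self u = trans (sum-cong-≗ (λ z → []-idem (adj G u z))) (row-sum u)

    common-adjacent : ∀ {u v} → u ≢ v → adj G u v ≡ true → sum (λ z → A G u z * A G v z) ≡ + λ′
    common-adjacent {u} {v} u≢v e =
      trans (sym (commonNbrs≡sum G u v)) (cong +_ (proj₁ (proj₂ srg) u v u≢v (Equivalence.from T-≡ e)))

    common-nonadjacent : ∀ {u v} → u ≢ v → adj G u v ≡ false → sum (λ z → A G u z * A G v z) ≡ + μ
    common-nonadjacent {u} {v} u≢v e =
      trans (sym (commonNbrs≡sum G u v)) (cong +_ (proj₂ (proj₂ srg) u v u≢v (subst T e)))

    common-neighbours : ∀ u v →
      sum (λ z → A G u z * A G v z) ≡ + μ + (+ k - + μ) * δ u v + (+ λ′ - + μ) * A G u v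
    common-neighbours u v with u ≟ v | adj G u v in e
    ... | yes refl | true  with trans (sym e) (irreflex G u)
    ...   | ()
    common-neighbours u v | yes refl | false = trans (common-self u) (on-diagonal (+ k) (+ λ′) (+ μ))
      where on-diagonal : ∀ k l m → k ≡ m + (k - m) * 1ℤ + (l - m) * 0ℤ
            on-diagonal = solve-∀
    common-neighbours u v | no u≢v | true  = trans (common-adjacent u≢v e) (on-edge (+ k) (+ λ′) (+ μ))
      where on-edge : ∀ k l m → l ≡ m + (k - m) * 0ℤ + (l - m) * 1ℤ
            on-edge = solve-∀
    common-neighbours u v | no u≢v | false = trans (common-nonadjacent u≢v e) (off-edge (+ k) (+ λ′) (+ μ))
      where off-edge : ∀ k l m → m ≡ m + (k - m) * 0ℤ + (l - m) * 0ℤ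
            off-edge = solve-∀

  module IsoregularEdge {N : ℕ} (G : Graph N) {k λ′ μ : ℕ} (srg : IsStronglyRegular G k λ′ μ)
                        {x y : Fin N} {Q R W : ℕ} (iso : Is3IsoregularEdge G x y Q R W) where

    open StronglyRegular G srg

    x≢y : x ≢ y
    x≢y = proj₁ iso

    x∼y : adj G x y ≡ true
    x∼y = Equivalence.to T-≡ (proj₁ (proj₂ iso))

    y∼x : adj G y x ≡ true
    y∼x = trans (symmetric G y x) x∼y

    a b : Fin N → Bool
    a = adj G x
    b = adj G y

    Λ : Fin N → ℤ
    Λ w = A G x w * A G y w

    V : Fin N → ℤ
    V = valency G x y

    common-count : sum Λ ≡ + λ′
    common-count = common-adjacent x≢y x∼y

    sum-over-common : ∀ (F : Fin N → ℤ) c → (∀ w → a w ≡ true → b w ≡ true → F w ≡ c) →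
      sum (λ w → Λ w * F w) ≡ c * + λ′
    sum-over-common F c const = begin
      sum (λ w → Λ w * F w)   ≡⟨ sum-cong-≗ at ⟩
      sum (λ w → c * Λ w)     ≡⟨ sym (*-distribˡ-sum c Λ) ⟩
      c * sum Λ               ≡⟨ cong (c *_) common-count ⟩
      c * + λ′                ∎
      where
      at : ∀ w → Λ w * F w ≡ c * Λ w
      at w with a w in ex | b w in ey
      ... | true  | true  = trans (ℤ.*-identityˡ (F w)) (trans (const w ex ey) (sym (ℤ.*-identityʳ c)))
      ... | true  | false = sym (ℤ.*-zeroʳ c)
      ... | false | _     = sym (ℤ.*-zeroʳ c)

    valency-x : V x ≡ + λ′
    valency-x = trans (sum-cong-≗ (λ w → idem (a w) (b w))) common-count
      where idem : ∀ p q → [ p ] * [ q ] * [ p ] ≡ [ p ] * [ q ]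
            idem true  true  = refl
            idem true  false = refl
            idem false _     = refl

    valency-y : V y ≡ + λ′
    valency-y = trans (sum-cong-≗ (λ w → idem (a w) (b w))) common-count
      where idem : ∀ p q → [ p ] * [ q ] * [ q ] ≡ [ p ] * [ q ]
            idem true  true  = refl
            idem true  false = refl
            idem false true  = refl
            idem false false = refl

    type-value : Bool → Bool → ℤ
    type-value true  true  = + Q
    type-value true  false = + R
    type-value false true  = + R
    type-value false false = + W

    valency3-cast : ∀ {z n} → valency3 G x y z ≡ n → V z ≡ + n
    valency3-cast {z} eq = trans (sym (valency3≡valency G x y z)) (cong +_ eq)

    valency-by-type : ∀ z → z ≢ x → z ≢ y → V z ≡ type-value (a z) (b z)
    valency-by-type z z≢x z≢y with a z in ex | b z in ey | proj₂ (proj₂ iso) z z≢x z≢y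
    ... | true  | true  | (K₃ , _ , _ , _)    = valency3-cast (K₃ (∼⇒Adj G ex) (∼⇒Adj G ey))
    ... | true  | false | (_ , K₁₂ , _ , _)   = valency3-cast (K₁₂ (∼⇒Adj G ex) (≁⇒¬Adj G ey))
    ... | false | true  | (_ , _ , K₁₂ , _)   = valency3-cast (K₁₂ (≁⇒¬Adj G ex) (∼⇒Adj G ey))
    ... | false | false | (_ , _ , _ , K₂+K₁) = valency3-cast (K₂+K₁ (≁⇒¬Adj G ex) (≁⇒¬Adj G ey))

    valency-common : ∀ w → a w ≡ true → b w ≡ true → V w ≡ + Q
    valency-common w ex ey =
      trans (valency-by-type w (≢-sym (∼⇒≢ G ex)) (≢-sym (∼⇒≢ G ey))) (cong₂ type-value ex ey)

    sum-by-class : ∀ (φ : Bool → Bool → ℤ → ℤ) →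
      sum (λ z → φ (a z) (b z) (V z)) ≡
        φ false true (+ λ′) + φ true false (+ λ′) + + λ′ * φ true true (+ Q)
        + (+ k - 1ℤ - + λ′) * φ true false (+ R) + (+ k - 1ℤ - + λ′) * φ false true (+ R)
        + (+ N - (+ k + + k) + + λ′) * φ false false (+ W)
    sum-by-class φ = begin
      sum F                                                ≡⟨ sum-cong-≗ (λ z → split (F z) (F′ z)) ⟩
      sum (λ z → F′ z + (F z - F′ z))                      ≡⟨ ∑-distrib-+ F′ (λ z → F z - F′ z) ⟩
      sum F′ + sum (λ z → F z - F′ z)                      ≡⟨ cong₂ _+_ typical exceptional ⟩
      + N * w + (u - w) * + k + (v - w) * + k + (t - u - v + w) * + λ′
        + ((φx - v) + (φy - u))
                                                           ≡⟨ rearrange (+ N) (+ k) (+ λ′) t u v w φy φx ⟩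
      φx + φy + + λ′ * t + (+ k - 1ℤ - + λ′) * u + (+ k - 1ℤ - + λ′) * v
        + (+ N - (+ k + + k) + + λ′) * w                   ∎
      where
      F F′ : Fin N → ℤ
      F  z = φ (a z) (b z) (V z)
      F′ z = φ (a z) (b z) (type-value (a z) (b z))
      φx φy t u v w : ℤ
      φx = φ false true (+ λ′)
      φy = φ true false (+ λ′)
      t = φ true true (+ Q)
      u = φ true false (+ R)
      v = φ false true (+ R)
      w = φ false false (+ W)

      split : ∀ p q → p ≡ q + (p - q)
      split = solve-∀

      rearrange : ∀ n k l t u v w c d →
        n * w + (u - w) * k + (v - w) * k + (t - u - v + w) * l + ((d - v) + (c - u))
          ≡ d + c + l * t + (k - 1ℤ - l) * u + (k - 1ℤ - l) * v + (n - (k + k) + l) * w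
      rearrange = solve-∀

      typical : sum F′ ≡ + N * w + (u - w) * + k + (v - w) * + k + (t - u - v + w) * + λ′
      typical = sum-bilinear a b (λ p q → φ p q (type-value p q)) (row-sum x) (row-sum y) common-count

      vanish : ∀ z → z ≢ x → z ≢ y → F z - F′ z ≡ 0ℤ
      vanish z z≢x z≢y rewrite valency-by-type z z≢x z≢y = ℤ.+-inverseʳ (F′ z)

      at-x : F x - F′ x ≡ φx - v
      at-x rewrite irreflex G x | y∼x | valency-x = refl

      at-y : F y - F′ y ≡ φy - u
      at-y rewrite irreflex G y | x∼y | valency-y = refl

      exceptional : sum (λ z → F z - F′ z) ≡ (φx - v) + (φy - u)
      exceptional = trans (sum-supported-on-pair (λ z → F z - F′ z) x≢y vanish) (cong₂ _+_ at-x at-y)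

    sum-valency : sum V ≡ + k * + λ′
    sum-valency = begin
      sum V                                       ≡⟨ sum-cong-≗ (λ z → sym (ℤ.*-identityˡ (V z))) ⟩
      sum (λ z → 1ℤ * V z)                        ≡⟨ double-counting G x y (λ _ → 1ℤ) ⟩
      sum (λ w → Λ w * sum (λ z → 1ℤ * A G w z))  ≡⟨ sum-over-common _ (+ k) degree-k ⟩
      + k * + λ′                                  ∎
      where
      degree-k : ∀ w → a w ≡ true → b w ≡ true → sum (λ z → 1ℤ * A G w z) ≡ + k
      degree-k w _ _ = trans (sum-cong-≗ (λ z → ℤ.*-identityˡ (A G w z))) (row-sum w)

    sum-neighbour-valency : sum (λ z → A G x z * V z) ≡ + λ′ * + λ′
    sum-neighbour-valency = trans (double-counting G x y (A G x))
      (sum-over-common _ (+ λ′) (λ w ex _ → common-adjacent (∼⇒≢ G ex) ex))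

    second-neighbourhood : ∀ w → a w ≡ true → b w ≡ true →
      sum (λ z → A G w z * V z) ≡ + k + + λ′ * + Q + + μ * (+ λ′ - 1ℤ - + Q)
    second-neighbourhood w ex ey = begin
      sum (λ z → A G w z * V z)
        ≡⟨ double-counting G x y (A G w) ⟩
      sum (λ v → Λ v * sum (λ z → A G w z * A G v z))
        ≡⟨ sum-cong-≗ (λ v → trans (cong (Λ v *_) (common-neighbours w v))
                                   (expand (+ μ) k-μ λ′-μ (Λ v) (δ w v) (A G w v))) ⟩
      sum (λ v → + μ * Λ v + k-μ * (δ w v * Λ v) + λ′-μ * (Λ v * A G w v))
        ≡⟨ sum-+-* (λ v → + μ * Λ v + k-μ * (δ w v * Λ v)) (λ v → Λ v * A G w v) λ′-μ ⟩
      sum (λ v → + μ * Λ v + k-μ * (δ w v * Λ v)) + λ′-μ * V w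
        ≡⟨ cong₂ (λ s r → s + λ′-μ * r) (sum-+-* (λ v → + μ * Λ v) (λ v → δ w v * Λ v) k-μ)
                                        (valency-common w ex ey) ⟩
      sum (λ v → + μ * Λ v) + k-μ * sum (λ v → δ w v * Λ v) + λ′-μ * + Q
        ≡⟨ cong₂ (λ s r → s + k-μ * r + λ′-μ * + Q)
                 (trans (sym (*-distribˡ-sum (+ μ) Λ)) (cong (+ μ *_) common-count))
                 (trans (sum-δ w Λ) (cong₂ (λ p q → [ p ] * [ q ]) ex ey)) ⟩
      + μ * + λ′ + k-μ * 1ℤ + λ′-μ * + Q
        ≡⟨ tidy (+ k) (+ λ′) (+ μ) (+ Q) ⟩
      + k + + λ′ * + Q + + μ * (+ λ′ - 1ℤ - + Q)
        ∎
      where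
      k-μ λ′-μ : ℤ
      k-μ = + k - + μ
      λ′-μ = + λ′ - + μ
      expand : ∀ m p q c d e → c * (m + p * d + q * e) ≡ m * c + p * (d * c) + q * (c * e)
      expand = solve-∀
      tidy : ∀ k l m q → m * l + (k - m) * 1ℤ + (l - m) * q ≡ k + l * q + m * (l - 1ℤ - q)
      tidy = solve-∀

    sum-valency-square : sum (λ z → V z * V z) ≡ (+ k + + λ′ * + Q + + μ * (+ λ′ - 1ℤ - + Q)) * + λ′
    sum-valency-square = trans (double-counting G x y V) (sum-over-common _ _ λ w ex ey →
      trans (sum-cong-≗ (λ z → ℤ.*-comm (V z) (A G w z))) (second-neighbourhood w ex ey))

    isoregular-equations : IsoregularEquations (+ k) (+ λ′) (+ μ) (+ N) (+ Q) (+ R) (+ W)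
    isoregular-equations = record
      { neighbour-valency-sum =
          trans (weights (+ k) (+ λ′) (+ N) (+ Q) (+ R) (+ W))
                (trans (sym (sum-by-class (λ p _ v → [ p ] * v))) sum-neighbour-valency)
      ; valency-sum        = trans (sym (sum-by-class (λ _ _ v → v))) sum-valency
      ; valency-square-sum = trans (sym (sum-by-class (λ _ _ v → v * v))) sum-valency-square
      }
      where
      weights : ∀ k l n q r w → l + l * q + (k - 1ℤ - l) * r
        ≡ 0ℤ * l + 1ℤ * l + l * (1ℤ * q) + (k - 1ℤ - l) * (1ℤ * r) + (k - 1ℤ - l) * (0ℤ * r)
          + (n - (k + k) + l) * (0ℤ * w)
      weights = solve-∀

module ParameterSolving where

  open Counting using (IsoregularEquations; module IsoregularEquations)
  open import Data.Integer using (ℤ; +_; 0ℤ; 1ℤ; _+_; _*_; _-_; -_)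
  import Data.Integer.Properties as ℤ
  open import Data.Integer.Tactic.RingSolver using (solve)
  open import Data.List using ([]; _∷_)
  open import Data.Integer.Divisibility.Signed using (_∣_; divides)
  open import Data.Product using (_×_; _,_)
  open import Data.Sum using (inj₁; inj₂)
  open import Relation.Binary.PropositionalEquality using (_≡_; _≢_; refl; trans; cong)
  open import Relation.Nullary using (¬_)
  open import Data.Empty using (⊥-elim)

  FamilyEquations : ℤ → ℤ → ℤ → ℤ → Set
  FamilyEquations M Q R W =
    IsoregularEquations (M * (+ 2 * M + 1ℤ)) (M * M - 1ℤ) (M * M) (+ 2 * (1ℤ + (+ 2 * M * M + + 2 * M))) Q R W

  cancel-nonzero : ∀ {c x} → c ≢ 0ℤ → c * x ≡ 0ℤ → x ≡ 0ℤ
  cancel-nonzero {c} c≢0 cx≡0 with ℤ.i*j≡0⇒i≡0∨j≡0 c cx≡0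
  ... | inj₁ c≡0 = ⊥-elim (c≢0 c≡0)
  ... | inj₂ x≡0 = x≡0

  vanishes-by : ∀ {p q : ℤ} → q ≡ 0ℤ → p ≡ q → p ≡ 0ℤ
  vanishes-by q≡0 p≡q = trans p≡q q≡0

  scale-zero : ∀ c {a} → a ≡ 0ℤ → c * a ≡ 0ℤ
  scale-zero c a≡0 = trans (cong (c *_) a≡0) (ℤ.*-zeroʳ c)

  add-zeros : ∀ {a b} → a ≡ 0ℤ → b ≡ 0ℤ → a + b ≡ 0ℤ
  add-zeros refl refl = refl

  module _ (M Q R W : ℤ) (eqs : FamilyEquations M Q R W) where
    open IsoregularEquations eqs

    R-relation : M + 1ℤ ≢ 0ℤ → M * R - (M - 1ℤ) * (M * M - + 2 - Q) ≡ 0ℤ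
    R-relation M+1≢0 = cancel-nonzero M+1≢0
      (vanishes-by (ℤ.i≡j⇒i-j≡0 neighbour-valency-sum) (solve (M ∷ Q ∷ R ∷ [])))

    W-relation : M + 1ℤ ≢ 0ℤ → (M + 1ℤ) * W - (M - 1ℤ) * (M + + 2 + Q) ≡ 0ℤ
    W-relation M+1≢0 = cancel-nonzero M+1≢0 (vanishes-by
      (add-zeros (ℤ.i≡j⇒i-j≡0 valency-sum) (scale-zero (- (+ 2 * (M + 1ℤ))) (R-relation M+1≢0)))
      (solve (M ∷ Q ∷ R ∷ W ∷ [])))

    -- Multiplied by M, the R² and W² terms become 2(M + 1)(MR)² and M((M + 1)W)², which the
    -- two relations eliminate.
    Q-quadratic : M + 1ℤ ≢ 0ℤ → M - 1ℤ ≢ 0ℤ →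
      (+ 2 * Q + M + + 4 - M * M) * ((+ 2 * M * M - 1ℤ) * Q - (M * M * M * M - + 3 * M * M + M + + 2)) ≡ 0ℤ
    Q-quadratic M+1≢0 M-1≢0 = cancel-nonzero M-1≢0 (vanishes-by
      (add-zeros (add-zeros (scale-zero M (ℤ.i≡j⇒i-j≡0 valency-square-sum))
                    (scale-zero (- (+ 2 * (M + 1ℤ) * (M * R + (M - 1ℤ) * (M * M - + 2 - Q))))
                                (R-relation M+1≢0)))
             (scale-zero (- (M * ((M + 1ℤ) * W + (M - 1ℤ) * (M + + 2 + Q)))) (W-relation M+1≢0)))
      (solve (M ∷ Q ∷ R ∷ W ∷ [])))

    second-root-divisibility :
      (+ 2 * M * M - 1ℤ) * Q - (M * M * M * M - + 3 * M * M + M + + 2) ≡ 0ℤ →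
      + 2 * M * M - 1ℤ ∣ + 4 * M + + 3
    second-root-divisibility f₂≡0 = divides (+ 4 * Q - + 2 * M * M + + 5)
      (ℤ.i-j≡0⇒i≡j _ _ (vanishes-by (scale-zero (- + 4) f₂≡0) (solve (M ∷ Q ∷ []))))

    first-root : M ≢ 0ℤ → M + 1ℤ ≢ 0ℤ → + 2 * Q + M + + 4 - M * M ≡ 0ℤ →
      (+ 2 * Q + M + + 4 ≡ M * M) × (+ 2 * R + 1ℤ ≡ M * M) × (+ 2 * W ≡ M * (M - 1ℤ))
    first-root M≢0 M+1≢0 f₁≡0 =
        ℤ.i-j≡0⇒i≡j _ _ f₁≡0
      , ℤ.i-j≡0⇒i≡j _ _ (cancel-nonzero M≢0 (vanishes-by
          (add-zeros (scale-zero (+ 2) (R-relation M+1≢0)) (scale-zero (- (M - 1ℤ)) f₁≡0))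
          (solve (M ∷ Q ∷ R ∷ []))))
      , ℤ.i-j≡0⇒i≡j _ _ (cancel-nonzero M+1≢0 (vanishes-by
          (add-zeros (scale-zero (+ 2) (W-relation M+1≢0)) (scale-zero (M - 1ℤ) f₁≡0))
          (solve (M ∷ Q ∷ W ∷ []))))

  isoregular-parameters : ∀ {k l u n} M Q R W →
    k ≡ M * (+ 2 * M + 1ℤ) → l ≡ M * M - 1ℤ → u ≡ M * M →
    n ≡ + 2 * (1ℤ + (+ 2 * M * M + + 2 * M)) →
    IsoregularEquations k l u n Q R W →
    M ≢ 0ℤ → M + 1ℤ ≢ 0ℤ → M - 1ℤ ≢ 0ℤ → ¬ (+ 2 * M * M - 1ℤ ∣ + 4 * M + + 3) →
    (+ 2 * Q + M + + 4 ≡ M * M) × (+ 2 * R + 1ℤ ≡ M * M) × (+ 2 * W ≡ M * (M - 1ℤ))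
  isoregular-parameters M Q R W refl refl refl refl eqs M≢0 M+1≢0 M-1≢0 ∤
    with ℤ.i*j≡0⇒i≡0∨j≡0 _ (Q-quadratic M Q R W eqs M+1≢0 M-1≢0)
  ... | inj₁ f₁≡0 = first-root M Q R W eqs M≢0 M+1≢0 f₁≡0
  ... | inj₂ f₂≡0 = ⊥-elim (∤ (second-root-divisibility M Q R W eqs f₂≡0))

module Integrality where

  open import Data.Nat using (ℕ; suc; _+_; _*_; _∸_; _≤_; s≤s)
  open import Data.Nat.DivMod using (_%_; m%n<n; %-distribˡ-*; [m+kn]%n≡m%n)
  open import Data.Nat.Divisibility using (_∣_; ∣⇒≤; _∣?_)
  open import Data.Nat.Properties using (+-comm; *-comm; m+1+n≰m)
  open import Data.Nat.Tactic.RingSolver using (solve-∀)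
  open import Relation.Binary.PropositionalEquality using (_≡_; refl; sym; trans; cong; subst)
  open import Relation.Nullary using (¬_)
  open import Relation.Nullary.Decidable using (from-no)

  [2r+1]%2≡1 : ∀ r → (2 * r + 1) % 2 ≡ 1
  [2r+1]%2≡1 r =
    trans (cong (_% 2) (trans (+-comm (2 * r) 1) (cong (1 +_) (*-comm 2 r)))) ([m+kn]%n≡m%n 1 r 2)

  odd-square : ∀ {m r} → 2 * r + 1 ≡ m * m → m % 2 ≡ 1
  odd-square {m} {r} 2r+1≡m² with m % 2 | m%n<n m 2 | %-distribˡ-* m m 2
  ... | 1           | _            | _      = refl
  ... | suc (suc _) | s≤s (s≤s ()) | _
  ... | 0           | _            | m²%2≡0
    with trans (sym ([2r+1]%2≡1 r)) (trans (cong (_% 2) 2r+1≡m²) m²%2≡0)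
  ...   | ()

  2m²-1∤4m+3 : ∀ m → 2 ≤ m → ¬ (2 * m * m ∸ 1 ∣ 4 * m + 3)
  2m²-1∤4m+3 1 (s≤s ())
  2m²-1∤4m+3 2 _ = from-no (7 ∣? 11)
  2m²-1∤4m+3 (suc (suc (suc n))) _ d∣c =
    m+1+n≰m (4 * (3 + n) + 3) (subst (_≤ 4 * (3 + n) + 3) (cong (_∸ 1) (excess n)) (∣⇒≤ d∣c))
    where
    excess : ∀ n → 2 * (3 + n) * (3 + n) ≡ suc (4 * (3 + n) + 3 + suc (1 + 8 * n + 2 * n * n))
    excess = solve-∀

module NaturalToInteger where

  open Integrality using (2m²-1∤4m+3)
  open import Data.Nat as ℕ using (suc; _≤_; s≤s; z≤n)
  open import Data.Integer using (+_; 1ℤ; _+_; _*_; _-_)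
  import Data.Integer.Properties as ℤ
  open import Data.Integer.Divisibility.Signed using (_∣_; ∣⇒∣ᵤ)
  open import Relation.Binary.PropositionalEquality using (_≡_; sym; trans; cong; cong₂; subst₂)
  open import Relation.Nullary using (¬_)

  from-ℤ : ∀ {a b i j} → + a ≡ i → + b ≡ j → i ≡ j → a ≡ b
  from-ℤ a≡i b≡j i≡j = ℤ.+-injective (trans a≡i (trans i≡j (sym b≡j)))

  pred-cast : ∀ {a} → 1 ≤ a → + (a ℕ.∸ 1) ≡ + a - 1ℤ
  pred-cast {a} 1≤a = sym (trans (ℤ.[+m]-[+n]≡m⊖n a 1) (ℤ.⊖-≥ 1≤a))

  square-cast : ∀ m → + (m ℕ.* m) ≡ + m * + m
  square-cast m = ℤ.pos-* m m

  twice-square-cast : ∀ m → + (2 ℕ.* m ℕ.* m) ≡ + 2 * + m * + m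
  twice-square-cast m = trans (ℤ.pos-* (2 ℕ.* m) m) (cong (_* + m) (ℤ.pos-* 2 m))

  degree-cast : ∀ m → + (m ℕ.* (2 ℕ.* m ℕ.+ 1)) ≡ + m * (+ 2 * + m + 1ℤ)
  degree-cast m = trans (ℤ.pos-* m (2 ℕ.* m ℕ.+ 1))
    (cong (+ m *_) (trans (ℤ.pos-+ (2 ℕ.* m) 1) (cong (_+ 1ℤ) (ℤ.pos-* 2 m))))

  pred-square-cast : ∀ n → + (suc n ℕ.* suc n ℕ.∸ 1) ≡ + suc n * + suc n - 1ℤ
  pred-square-cast n = trans (pred-cast (s≤s z≤n)) (cong (_- 1ℤ) (square-cast (suc n)))

  order-cast : ∀ m →
    + (2 ℕ.* suc (2 ℕ.* m ℕ.* m ℕ.+ 2 ℕ.* m)) ≡ + 2 * (1ℤ + (+ 2 * + m * + m + + 2 * + m))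
  order-cast m = trans (ℤ.pos-* 2 (suc s)) (cong (+ 2 *_) (trans (ℤ.pos-+ 1 s) (cong (_+_ 1ℤ)
    (trans (ℤ.pos-+ (2 ℕ.* m ℕ.* m) (2 ℕ.* m)) (cong₂ _+_ (twice-square-cast m) (ℤ.pos-* 2 m))))))
    where
    s : ℕ.ℕ
    s = 2 ℕ.* m ℕ.* m ℕ.+ 2 ℕ.* m

  Q-cast : ∀ q m → + (2 ℕ.* q ℕ.+ m ℕ.+ 4) ≡ + 2 * + q + + m + + 4
  Q-cast q m = trans (ℤ.pos-+ (2 ℕ.* q ℕ.+ m) 4)
    (cong (_+ + 4) (trans (ℤ.pos-+ (2 ℕ.* q) m) (cong (_+ + m) (ℤ.pos-* 2 q))))

  R-cast : ∀ r → + (2 ℕ.* r ℕ.+ 1) ≡ + 2 * + r + 1ℤ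
  R-cast r = trans (ℤ.pos-+ (2 ℕ.* r) 1) (cong (_+ 1ℤ) (ℤ.pos-* 2 r))

  W-cast : ∀ n → + (suc n ℕ.* (suc n ℕ.∸ 1)) ≡ + suc n * (+ suc n - 1ℤ)
  W-cast n = trans (ℤ.pos-* (suc n) n) (cong (+ suc n *_) (pred-cast (s≤s z≤n)))

  2M²-1∤4M+3 : ∀ m → 2 ≤ m → ¬ (+ 2 * + m * + m - 1ℤ ∣ + 4 * + m + + 3)
  2M²-1∤4M+3 m@(suc _) 2≤m d∣c =
    2m²-1∤4m+3 m 2≤m (∣⇒∣ᵤ (subst₂ _∣_ (sym d-cast) (sym c-cast) d∣c))
    where
    d-cast : + (2 ℕ.* m ℕ.* m ℕ.∸ 1) ≡ + 2 * + m * + m - 1ℤ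
    d-cast = trans (pred-cast (s≤s z≤n)) (cong (_- 1ℤ) (twice-square-cast m))
    c-cast : + (4 ℕ.* m ℕ.+ 3) ≡ + 4 * + m + + 3
    c-cast = trans (ℤ.pos-+ (4 ℕ.* m) 3) (cong (_+ + 3) (ℤ.pos-* 4 m))

open Counting using (module IsoregularEdge)
open ParameterSolving using (isoregular-parameters)
open Integrality using (odd-square)
open NaturalToInteger
open import Data.Nat using (ℕ; suc; _+_; _*_; _∸_; _≤_; s≤s)
open import Data.Nat.DivMod using (_%_)
open import Data.Fin using (Fin)
open import Data.Integer using (+_)
import Data.Integer.Properties as ℤ
open import Data.Product using (_×_; _,_)
open import Relation.Binary.PropositionalEquality using (_≡_)

proposition4p1 : (m : ℕ) → 2 ≤ m →
    (Γ : Graph (2 * suc (2 * m * m + 2 * m))) →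
    IsBicirculant Γ →
    IsStronglyRegular Γ (m * (2 * m + 1)) (m * m ∸ 1) (m * m) →
    (x y : Fin (2 * suc (2 * m * m + 2 * m))) (Q R W : ℕ) →
    Is3IsoregularEdge Γ x y Q R W →
    (m % 2 ≡ 1) × (2 * Q + m + 4 ≡ m * m) × (2 * R + 1 ≡ m * m) × (2 * W ≡ m * (m ∸ 1))
proposition4p1 1 (s≤s ())
proposition4p1 m@(suc (suc n)) 2≤m Γ _ srg x y Q R W iso
  with isoregular-parameters (+ m) (+ Q) (+ R) (+ W)
         (degree-cast m) (pred-square-cast (suc n)) (square-cast m) (order-cast m)
         (IsoregularEdge.isoregular-equations Γ srg iso)
         (λ ()) (λ ()) (λ ()) (2M²-1∤4M+3 m 2≤m)
... | Q-eq , R-eq , W-eq =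
  odd-square {m} {R} R-formula , from-ℤ (Q-cast Q m) (square-cast m) Q-eq , R-formula ,
  from-ℤ (ℤ.pos-* 2 W) (W-cast (suc n)) W-eq
  where
  R-formula : 2 * R + 1 ≡ m * m
  R-formula = from-ℤ (R-cast R) (square-cast m) R-eq
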